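{- Let $G=(V\cup\{s\},E)$ be a finite, connected, undirected, loop-free graph (multiple edges allowed) with sink $s\notin V$, and let $p\in(0,1)$. Then ${\sf Sto}(G)\subseteq\mathcal{V}(G)$, where $\mathcal{V}(G)=\bigcup_O{\sf comp}(O)$ is the set of stable configurations compatible with some orientation $O$ of $G$.
   Context: $d^G(v)$ is degree with multiplicity. Configurations $\eta\in\mathbb{Z}_{\ge0}^V$, stable if $\eta_v\le d^G(v)$ for all $v\in V$; $\eta^{\max}=(d^G(v))_{v\in V}$. In the stochastic sandpile model with parameter $p$, a legal stochastic toppling at $x\in V$ (allowed when $\eta_x>d^G(x)$) chooses independently for each edge $e=\{x,y\}$ at $x$ a Bernoulli($p$) variable $B_e$, removes $\sum_eB_e$ grains from $x$ and adds $B_e$ grains to $y$ if $y\ne s$. The Markov chain on stable configurations adds one grain at a random vertex of $V$ (distribution with support $V$), then performs legal stochastic topplings until stable; ${\sf Sto}(G)$ is its recurrent class containing $\eta^{\max}$. An orientation of $G$ orients every edge of $E$ (parallel edges independently); ${\sf in}_O(v)$ is the number of edges oriented into $v$. With $l_\eta(v)=d^G(v)-\eta_v$, $\eta$ is compatible with $O$ if ${\sf in}_O(v)\ge1+l_\eta(v)$ for all $v\in V$; ${\sf comp}(O)$ is the set of stable configurations compatible with $O$. -}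

module Defs where

open import Data.Nat using (ℕ; zero; suc; _+_; _∸_; _≤_; _<_)
open import Data.Fin using (Fin; zero; suc; _≟_)
open import Data.List using (List; map)
open import Data.Nat.ListAction using (sum)
open import Data.Fin.Base using ()
open import Data.List using ()
open import Data.Bool using (Bool; true; false; if_then_else_; _∧_; _∨_; not)
open import Data.Product using (Σ; _×_; _,_; proj₁; proj₂; ∃)
open import Data.Sum using (_⊎_)
open import Relation.Nullary using (¬_)
open import Relation.Nullary.Decidable using (⌊_⌋)
open import Relation.Binary.PropositionalEquality using (_≡_; _≢_)
open import Relation.Binary.Construct.Closure.ReflexiveTransitive using (Star)
open import Data.Rational using (ℚ) renaming (_<_ to _<ℚ_)
import Data.Rational as ℚ

allFin' : (m : ℕ) → List (Fin m)
allFin' m = Data.List.allFin m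

count : {m : ℕ} → (Fin m → Bool) → ℕ
count {m} P = sum (map (λ i → if P i then 1 else 0) (allFin' m))

-- Vertex set V ∪ {s} is Fin (suc n); the sink s is 'zero',
-- the non-sink vertex v : Fin n is 'suc v'.  Edges form a finite
-- family indexed by Fin m (so parallel edges are allowed); edge e has
-- the (unordered) end-points 'ends e'.

Vtx : ℕ → Set
Vtx n = Fin (suc n)

sink : {n : ℕ} → Vtx n
sink = zero

record Graph (n : ℕ) : Set where
  field
    m     : ℕ
    ends  : Fin m → Vtx n × Vtx n

  Adj : Vtx n → Vtx n → Set
  Adj a b = ∃ λ e → (ends e ≡ (a , b)) ⊎ (ends e ≡ (b , a))

  field
    loopFree  : ∀ e → proj₁ (ends e) ≢ proj₂ (ends e)
    connected : ∀ a b → Star Adj a b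

module _ {n : ℕ} (G : Graph n) where
  open Graph G

  _==_ : Vtx n → Vtx n → Bool
  a == b = ⌊ a ≟ b ⌋

  incident : Vtx n → Fin m → Bool
  incident a e = (proj₁ (ends e) == a) ∨ (proj₂ (ends e) == a)

  -- the other end-point of e seen from a (meaningful when incident)
  other : Vtx n → Fin m → Vtx n
  other a e = if proj₁ (ends e) == a then proj₂ (ends e) else proj₁ (ends e)

  deg : Vtx n → ℕ
  deg a = count (incident a)

  Config : Set
  Config = Fin n → ℕ

  Stable : Config → Set
  Stable η = ∀ v → η v ≤ deg (suc v)

  ηmax : Config
  ηmax v = deg (suc v)

  addGrain : Fin n → Config → Config
  addGrain v η w = if ⌊ w ≟ v ⌋ then suc (η w) else η w

  -- the Bernoulli(p) value b has positive probability
  BernSupp : ℚ → Bool → Set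
  BernSupp p true  = ℚ.0ℚ <ℚ p
  BernSupp p false = p <ℚ ℚ.1ℚ

  -- result of toppling x with the edge choices B : Fin m → Bool
  -- (B e = true means a grain is sent along e)
  toppleWith : Fin n → (Fin m → Bool) → Config → Config
  toppleWith x B η y =
    (if ⌊ y ≟ x ⌋ then η y ∸ count (λ e → incident (suc x) e ∧ B e) else η y)
    + count (λ e → incident (suc x) e ∧ B e ∧ (other (suc x) e == suc y))

  data Topple (p : ℚ) : Config → Config → Set where
    topple : ∀ {η} (x : Fin n) (B : Fin m → Bool) →
             deg (suc x) < η x →
             (∀ e → incident (suc x) e ≡ true → BernSupp p (B e)) →
             Topple p η (toppleWith x B η)

  -- one step of the Markov chain with positive probability:
  -- add a grain at some v ∈ V, then legal topplings until stable
  Step : ℚ → Config → Config → Set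
  Step p η η' = Σ (Fin n) λ v → Star (Topple p) (addGrain v η) η' × Stable η'

  Reach : ℚ → Config → Config → Set
  Reach p = Star (Step p)

  -- Sto(G): the (recurrent) communicating class of ηmax
  Sto : ℚ → Config → Set
  Sto p η = Reach p ηmax η × Reach p η ηmax

  -- Orientations: O e = true orients e from proj₁ (ends e) to
  -- proj₂ (ends e); O e = false the other way.

  Orientation : Set
  Orientation = Fin m → Bool

  head : Orientation → Fin m → Vtx n
  head O e = if O e then proj₂ (ends e) else proj₁ (ends e)

  inDeg : Orientation → Vtx n → ℕ
  inDeg O a = count (λ e → head O e == a)

  l : Config → Fin n → ℕ
  l η v = deg (suc v) ∸ η v

  Compatible : Config → Orientation → Set
  Compatible η O = ∀ v → suc (l η v) ≤ inDeg O (suc v)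

  comp : Orientation → Config → Set
  comp O η = Stable η × Compatible η O

  𝒱 : Config → Set
  𝒱 η = Σ Orientation λ O → comp O η

module Submission where

-- The proof follows one invariant through the chain.  Call (η , O) weakly
-- compatible when  d(v) < in_O(v) + η_v  for every v ∈ V; for a stable η
-- this is exactly compatibility (l_η(v) = d(v) − η_v is then an honest
-- difference).

open import Defs
open import Data.Nat using (ℕ)
open import Data.Rational using (ℚ; 0ℚ; 1ℚ; _<_)

open import Data.Nat as ℕ using (zero; suc; _+_; _∸_; _≤_; _<?_; z≤n; s≤s)
open import Data.Nat.Properties
  using ( ≤-refl; ≤-trans; <-asym; 1+n≰n; n≤1+n; m≤m+n; m≤n+m; m≤n+m∸n
        ; m∸n+n≡m; +-mono-≤; +-monoˡ-≤; +-monoʳ-≤; +-cancelʳ-≤; +-assoc; +-comm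
        ; +-commutativeSemigroup; module ≤-Reasoning)
open import Algebra.Properties.CommutativeSemigroup +-commutativeSemigroup
  using (interchange)
open import Data.Nat.ListAction using (sum)
open import Data.Fin using (Fin; zero; suc; _≟_)
open import Data.Fin.Properties using (suc-injective)
open import Data.List using (List; []; _∷_; map; allFin)
open import Data.Bool.ListAction using (any)
open import Data.List.Membership.Propositional using (_∈_; lose)
open import Data.List.Membership.Propositional.Properties using (∈-allFin)
open import Data.List.Relation.Unary.Any using (here; there; satisfied)
open import Data.List.Relation.Unary.Any.Properties using (any⁺; any⁻)
open import Data.Bool using (Bool; true; false; if_then_else_; _∧_; _∨_; T; T?)
open import Data.Bool.Properties using (T-∧; T-∨)
open import Data.Product using (_×_; _,_; proj₁; proj₂; ∃)
open import Data.Sum using (_⊎_; inj₁; inj₂)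
open import Data.Empty using (⊥-elim)
open import Data.Unit using (tt)
open import Function using (_∘_)
open import Function.Bundles using (Equivalence)
open import Relation.Nullary using (¬_; yes; no)
open import Relation.Nullary.Decidable using (⌊_⌋; toWitness; fromWitness)
open import Relation.Binary.PropositionalEquality using (_≡_; _≢_; refl; sym; cong; subst)
open import Relation.Binary.Construct.Closure.ReflexiveTransitive using (Star; ε; _◅_)

open Equivalence using (to; from)

star-invariant : {A : Set} {R : A → A → Set} (P : A → Set) →
                 (∀ {a b} → R a b → P a → P b) →
                 ∀ {a b} → Star R a b → P a → P b
star-invariant P preserve ε        pa = pa
star-invariant P preserve (r ◅ rs) pa = star-invariant P preserve rs (preserve r pa)

least : (ℕ → Bool) → ℕ → ℕ
least D zero    = zero
least D (suc N) = if D zero then zero else suc (least (D ∘ suc) N)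

least-holds : (D : ℕ → Bool) (N : ℕ) → T (D N) → T (D (least D N))
least-holds D zero    dN = dN
least-holds D (suc N) dN with D zero in eq
... | true  = subst T (sym eq) tt
... | false = least-holds (D ∘ suc) N dN

least-minimal : (D : ℕ → Bool) (N k : ℕ) → T (D k) → least D N ≤ k
least-minimal D zero    k       dk = z≤n
least-minimal D (suc N) k       dk with D zero in eq
least-minimal D (suc N) k       dk | true  = z≤n
least-minimal D (suc N) zero    dk | false = ⊥-elim (subst T eq dk)
least-minimal D (suc N) (suc k) dk | false = s≤s (least-minimal (D ∘ suc) N k dk)

-- Counting along a list.  The count of the graph definitions is, by
-- definition, count P = countIn P (allFin m).
indicator : Bool → ℕ
indicator b = if b then 1 else 0

countIn : {A : Set} → (A → Bool) → List A → ℕ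
countIn P xs = sum (map (indicator ∘ P) xs)

countIn-mono : {A : Set} (P Q : A → Bool) (xs : List A) →
               (∀ x → T (P x) → T (Q x)) → countIn P xs ≤ countIn Q xs
countIn-mono P Q []       P⇒Q = z≤n
countIn-mono P Q (x ∷ xs) P⇒Q =
  +-mono-≤ (indicator-mono (P x) (Q x) (P⇒Q x)) (countIn-mono P Q xs P⇒Q)
  where
  indicator-mono : ∀ a b → (T a → T b) → indicator a ≤ indicator b
  indicator-mono false b     _   = z≤n
  indicator-mono true  true  _   = ≤-refl
  indicator-mono true  false a⇒b = ⊥-elim (a⇒b tt)

countIn-subadditive : {A : Set} (P Q R : A → Bool) (xs : List A) →
                      (∀ x → T (P x) → T (Q x) ⊎ T (R x)) →
                      countIn P xs ≤ countIn Q xs + countIn R xs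
countIn-subadditive P Q R []       P⇒Q∨R = z≤n
countIn-subadditive P Q R (x ∷ xs) P⇒Q∨R = begin
  indicator (P x) + countIn P xs
    ≤⟨ +-mono-≤ (indicator-subadditive (P x) (Q x) (R x) (P⇒Q∨R x))
                (countIn-subadditive P Q R xs P⇒Q∨R) ⟩
  (indicator (Q x) + indicator (R x)) + (countIn Q xs + countIn R xs)
    ≡⟨ interchange (indicator (Q x)) (indicator (R x)) (countIn Q xs) (countIn R xs) ⟩
  (indicator (Q x) + countIn Q xs) + (indicator (R x) + countIn R xs) ∎
  where
  open ≤-Reasoning
  indicator-subadditive : ∀ a b c → (T a → T b ⊎ T c) →
                          indicator a ≤ indicator b + indicator c
  indicator-subadditive false b c _ = z≤n
  indicator-subadditive true b c a⇒b∨c with a⇒b∨c tt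
  indicator-subadditive true true c     _ | inj₁ _  = s≤s z≤n
  indicator-subadditive true b    true  _ | inj₂ _  = m≤n+m 1 (indicator b)

countIn-pos : {A : Set} (P : A → Bool) {x : A} (xs : List A) →
              x ∈ xs → T (P x) → 1 ≤ countIn P xs
countIn-pos P (y ∷ xs) (here refl) py with P y
... | true = s≤s z≤n
countIn-pos P (y ∷ xs) (there x∈xs) px =
  ≤-trans (countIn-pos P xs x∈xs px) (m≤n+m _ (indicator (P y)))

module _ {n : ℕ} (G : Graph n) where
  open Graph G

  head-is-other : (O : Orientation G) {u : Vtx n} (e : Fin m) →
                  T (incident G u e) → head G O e ≢ u → head G O e ≡ other G u e
  head-is-other O {u} e = on-ends (proj₁ (ends e)) (proj₂ (ends e)) (O e)
    where
    on-ends : ∀ a b o → T (⌊ a ≟ u ⌋ ∨ ⌊ b ≟ u ⌋) → (if o then b else a) ≢ u →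
              (if o then b else a) ≡ (if ⌊ a ≟ u ⌋ then b else a)
    on-ends a b true  inc b≢u with a ≟ u
    ... | yes _   = refl
    ... | no  _   = ⊥-elim (b≢u (toWitness inc))
    on-ends a b false _   a≢u with a ≟ u
    ... | yes a≡u = ⊥-elim (a≢u a≡u)
    ... | no  _   = refl

  adjacency-edge : ∀ {a w} → Adj a w → ∃ λ e → T (incident G a e) × other G a e ≡ w
  adjacency-edge {a} {w} (e , ends≡) = e , on-ends (ends e) ends≡ (loopFree e)
    where
    on-ends : ∀ p → p ≡ (a , w) ⊎ p ≡ (w , a) → proj₁ p ≢ proj₂ p →
              T (⌊ proj₁ p ≟ a ⌋ ∨ ⌊ proj₂ p ≟ a ⌋) × (if ⌊ proj₁ p ≟ a ⌋ then proj₂ p else proj₁ p) ≡ w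
    on-ends .(a , w) (inj₁ refl) _ with a ≟ a
    ... | yes _   = tt , refl
    ... | no a≢a  = ⊥-elim (a≢a refl)
    on-ends .(w , a) (inj₂ refl) w≢a with w ≟ a | a ≟ a
    ... | yes w≡a | _      = ⊥-elim (w≢a w≡a)
    ... | no  _   | yes _  = tt , refl
    ... | no  _   | no a≢a = ⊥-elim (a≢a refl)

  within : ℕ → Vtx n → Bool
  within zero    u = _==_ G u sink
  within (suc k) u = within k u ∨ any (λ e → incident G u e ∧ within k (other G u e)) (allFin m)

  path-within : ∀ {u} → Star Adj u sink → ∃ λ k → T (within k u)
  path-within ε = zero , tt
  path-within {u} (adj ◅ path) with path-within path | adjacency-edge adj
  ... | k , near | e , inc , other≡w =
    suc k , from T-∨ (inj₂ (any⁺ (λ e → incident G u e ∧ within k (other G u e)) (lose (∈-allFin e)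
              (from T-∧ (inc , subst (T ∘ within k) (sym other≡w) near)))))

  closer-neighbour : ∀ u k → T (within (suc k) u) → ¬ T (within k u) →
                     ∃ λ e → T (incident G u e) × T (within k (other G u e))
  closer-neighbour u k near far with to T-∨ near
  ... | inj₁ nearK = ⊥-elim (far nearK)
  ... | inj₂ viaNeighbour = let e , ok = satisfied (any⁻ _ (allFin m) viaNeighbour)
                            in e , to T-∧ ok

  level : Vtx n → ℕ
  level u = least (λ k → within k u) (proj₁ (path-within (connected u sink)))

  level-holds : ∀ u → T (within (level u) u)
  level-holds u = let k , near = path-within (connected u sink)
                  in least-holds (λ k → within k u) k near

  level-minimal : ∀ u k → T (within k u) → level u ≤ k
  level-minimal u = least-minimal (λ k → within k u) (proj₁ (path-within (connected u sink)))

  level-descends : ∀ (v : Fin n) →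
    ∃ λ e → T (incident G (suc v) e) × level (other G (suc v) e) ℕ.< level (suc v)
  level-descends v
    with level (suc v) | level-holds (suc v) | level-minimal (suc v)
  ... | zero  | () | _
  ... | suc j | near | minimal =
    let e , inc , nearJ = closer-neighbour (suc v) j near (1+n≰n ∘ minimal j)
    in e , inc , s≤s (level-minimal _ j nearJ)

  ascending : (Vtx n → ℕ) → Orientation G
  ascending h e = ⌊ h (proj₁ (ends e)) <? h (proj₂ (ends e)) ⌋

  head-ascending : (h : Vtx n → ℕ) {u : Vtx n} (e : Fin m) →
                   T (incident G u e) → h (other G u e) ℕ.< h u → head G (ascending h) e ≡ u
  head-ascending h {u} e = on-ends (proj₁ (ends e)) (proj₂ (ends e))
    where
    on-ends : ∀ a b → T (⌊ a ≟ u ⌋ ∨ ⌊ b ≟ u ⌋) → h (if ⌊ a ≟ u ⌋ then b else a) ℕ.< h u →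
              (if ⌊ h a <? h b ⌋ then b else a) ≡ u
    on-ends a b inc lower with a ≟ u | b ≟ u
    ... | yes refl | _ with h a <? h b
    ...   | yes a<b = ⊥-elim (<-asym lower a<b)
    ...   | no  _   = refl
    on-ends a b inc lower | no _ | yes refl with h a <? h b
    ...   | yes _   = refl
    ...   | no a≮b  = ⊥-elim (a≮b lower)
    on-ends a b inc lower | no _ | no _ = ⊥-elim inc

  WeaklyCompatible : Config G → Orientation G → Set
  WeaklyCompatible η O = ∀ v → deg G (suc v) ℕ.< inDeg G O (suc v) + η v

  Orientable : Config G → Set
  Orientable η = ∃ (WeaklyCompatible η)

  weak⇒compatible : ∀ {η O} → Stable G η → WeaklyCompatible η O → Compatible G η O
  weak⇒compatible {η} {O} stable weak v =
    +-cancelʳ-≤ (η v) (suc (l G η v)) (inDeg G O (suc v))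
      (subst (ℕ._≤ inDeg G O (suc v) + η v) (cong suc (sym (m∸n+n≡m (stable v)))) (weak v))

  -- ηmax: orienting away from the sink gives every non-sink vertex an in-edge.
  ηmax-orientable : Orientable (ηmax G)
  ηmax-orientable = ascending level , λ v →
    let e , inc , lower = level-descends v
    in +-monoˡ-≤ (deg G (suc v))
         (countIn-pos (λ e → _==_ G (head G (ascending level) e) (suc v)) (allFin m)
            (∈-allFin e) (fromWitness (head-ascending level e inc lower)))

  addGrain-weak : ∀ {η O} v → WeaklyCompatible η O → WeaklyCompatible (addGrain G v η) O
  addGrain-weak {η} {O} v weak w =
    ≤-trans (weak w) (+-monoʳ-≤ (inDeg G O (suc w)) (addGrain-≥ w))
    where
    addGrain-≥ : ∀ w → η w ≤ addGrain G v η w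
    addGrain-≥ w with w ≟ v
    ... | yes _ = n≤1+n (η w)
    ... | no  _ = ≤-refl

  -- O with the edges selected by S turned towards u.
  redirect : Orientation G → (Fin m → Bool) → Vtx n → Orientation G
  redirect O S u e = if S e then _==_ G (proj₂ (ends e)) u else O e

  head-redirect-in : ∀ O S {u} e → T (S e) → T (incident G u e) → head G (redirect O S u) e ≡ u
  head-redirect-in O S {u} e = on-ends (proj₁ (ends e)) (proj₂ (ends e)) (S e) (O e)
    where
    on-ends : ∀ a b s o → T s → T (⌊ a ≟ u ⌋ ∨ ⌊ b ≟ u ⌋) →
              (if (if s then ⌊ b ≟ u ⌋ else o) then b else a) ≡ u
    on-ends a b true o _ inc with a ≟ u | b ≟ u
    ... | _       | yes b≡u = b≡u
    ... | yes a≡u | no _    = a≡u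
    ... | no _    | no _    = ⊥-elim inc

  head-redirect-out : ∀ O S u e → ¬ T (S e) → head G (redirect O S u) e ≡ head G O e
  head-redirect-out O S u e = on-ends (proj₁ (ends e)) (proj₂ (ends e)) (S e) (O e)
    where
    on-ends : ∀ a b s o → ¬ T s →
              (if (if s then ⌊ b ≟ u ⌋ else o) then b else a) ≡ (if o then b else a)
    on-ends a b true  o unselected = ⊥-elim (unselected tt)
    on-ends a b false o _          = refl

  fired : Fin n → (Fin m → Bool) → Fin m → Bool
  fired x B e = incident G (suc x) e ∧ B e

  inDeg-toppled : ∀ O x B →
    count (fired x B) ≤ inDeg G (redirect O (fired x B) (suc x)) (suc x)
  inDeg-toppled O x B =
    countIn-mono (fired x B) (λ e → _==_ G (head G O' e) (suc x)) (allFin m)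
      (λ e f → fromWitness (head-redirect-in O (fired x B) e f (proj₁ (to T-∧ f))))
    where O' = redirect O (fired x B) (suc x)

  inDeg-neighbour : ∀ O x B w → w ≢ suc x →
    inDeg G O w ≤ inDeg G (redirect O (fired x B) (suc x)) w
                  + count (λ e → incident G (suc x) e ∧ B e ∧ _==_ G (other G (suc x) e) w)
  inDeg-neighbour O x B w w≢x =
    countIn-subadditive (λ e → _==_ G (head G O e) w) (λ e → _==_ G (head G O' e) w)
      (λ e → incident G (suc x) e ∧ B e ∧ _==_ G (other G (suc x) e) w) (allFin m) kept-or-fired
    where
    O' = redirect O (fired x B) (suc x)
    kept-or-fired : ∀ e → T (_==_ G (head G O e) w) →
      T (_==_ G (head G O' e) w) ⊎ T (incident G (suc x) e ∧ B e ∧ _==_ G (other G (suc x) e) w)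
    kept-or-fired e into-w with T? (fired x B e)
    ... | no  unfired = inj₁ (subst (λ h → T (_==_ G h w))
                               (sym (head-redirect-out O (fired x B) (suc x) e unfired)) into-w)
    ... | yes f with to T-∧ f
    ...   | inc , sent =
      let head≡w = toWitness into-w
          head≡other = head-is-other O e inc (λ head≡x → w≢x (subst (_≡ suc x) head≡w head≡x))
      in inj₂ (from T-∧ (inc , from T-∧ (sent , fromWitness (subst (_≡ w) head≡other head≡w))))

  topple-weak : ∀ {η O} x B → deg G (suc x) ℕ.< η x → WeaklyCompatible η O →
                WeaklyCompatible (toppleWith G x B η) (redirect O (fired x B) (suc x))
  topple-weak {η} {O} x B unstable weak y with y ≟ x
  ... | yes refl = begin-strict
    deg G (suc x)                             <⟨ unstable ⟩
    η x                                       ≤⟨ m≤n+m∸n (η x) k ⟩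
    k + (η x ∸ k)                             ≤⟨ +-monoˡ-≤ (η x ∸ k) (inDeg-toppled O x B) ⟩
    inDeg G O' (suc x) + (η x ∸ k)            ≤⟨ +-monoʳ-≤ (inDeg G O' (suc x)) (m≤m+n (η x ∸ k) _) ⟩
    inDeg G O' (suc x) + (η x ∸ k + received) ∎
    where
    open ≤-Reasoning
    O' = redirect O (fired x B) (suc x)
    k = count (fired x B)
    received = count (λ e → incident G (suc x) e ∧ B e ∧ _==_ G (other G (suc x) e) (suc x))
  ... | no y≢x = begin-strict
    deg G (suc y)                             <⟨ weak y ⟩
    inDeg G O (suc y) + η y                   ≤⟨ +-monoˡ-≤ (η y) (inDeg-neighbour O x B (suc y) (y≢x ∘ suc-injective)) ⟩
    inDeg G O' (suc y) + received + η y       ≡⟨ +-assoc (inDeg G O' (suc y)) received (η y) ⟩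
    inDeg G O' (suc y) + (received + η y)     ≡⟨ cong (inDeg G O' (suc y) +_) (+-comm received (η y)) ⟩
    inDeg G O' (suc y) + (η y + received)     ∎
    where
    open ≤-Reasoning
    O' = redirect O (fired x B) (suc x)
    received = count (λ e → incident G (suc x) e ∧ B e ∧ _==_ G (other G (suc x) e) (suc y))

  step-orientable : ∀ {p η η'} → Step G p η η' → Orientable η → Orientable η'
  step-orientable (v , topplings , _) (O , weak) =
    star-invariant Orientable topple-orientable topplings (O , addGrain-weak v weak)
    where
    topple-orientable : ∀ {p η η'} → Topple G p η η' → Orientable η → Orientable η'
    topple-orientable (topple x B unstable _) (O , weak) = _ , topple-weak x B unstable weak

  reach-stable : ∀ {p η η'} → Reach G p η η' → Stable G η → Stable G η'
  reach-stable = star-invariant (Stable G) (λ (_ , _ , stable) _ → stable)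

lemma4p1 : (n : ℕ) (G : Graph n) (p : ℚ) → 0ℚ < p → p < 1ℚ →
    ∀ η → Sto G p η → 𝒱 G η
lemma4p1 n G p _ _ η (ηmax⇒η , _) =
  let O , weak = star-invariant (Orientable G) (step-orientable G) ηmax⇒η (ηmax-orientable G)
      stable   = reach-stable G ηmax⇒η (λ v → ≤-refl)
  in O , stable , weak⇒compatible G stable weak
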